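{- Let $\mathcal C\in\{\mathrm{ID},\mathrm{CD}\}$. The substitution rule is height-preserving admissible in $\mathsf{LBIQ}(\mathcal C)$: for every sequent $S$, variable $x$ and term $t$, if $S$ has a proof of height $n$ in $\mathsf{LBIQ}(\mathcal C)$, then $S(t/x)$ has a proof of height at most $n$ in $\mathsf{LBIQ}(\mathcal C)$.
   Context: Term substitution on sequents: for $S=\mathcal R,\mathcal T,\Gamma\vdash\Delta$, $S(t/x)$ is obtained by replacing every $w:\varphi$ in $\Gamma,\Delta$ by $w:\varphi(t/x)$ and replacing $\mathcal T$ by $\mathcal T(t/x)=(\mathcal T\setminus\{w:x\mid w:x\in\mathcal T\})\cup\{w:y\mid w:x\in\mathcal T,\ y\in\mathrm{VT}(t)\}$. Syntax. Terms from variables and function symbols (constants have arity $0$); $\mathrm{Ter}(X)$ = terms with variables in $X$ (contains all constants), $\mathrm{Ter}=\mathrm{Ter}(\mathrm{Var})$, $\mathrm{VT}(t)$ variables of $t$, $\mathrm{VT}(\vec t)=\bigcup_i\mathrm{VT}(t_i)$. Formulae: $\varphi::=p(\vec t)\mid\bot\mid\top\mid\varphi\wedge\varphi\mid\varphi\vee\varphi\mid\varphi\mathbin{ -\!\!<}\varphi\mid\varphi\to\varphi\mid\exists x\varphi\mid\forall x\varphi$ ($\mathbin{ -\!\!<}$ exclusion); $\varphi(t/x)$ capture-avoiding substitution (renaming bound variables). Sequents. Labeled formula $w:\varphi$, relational atom $wRu$, domain atom $w:x$. A sequent is $\mathcal R,\mathcal T,\Gamma\vdash\Delta$ ($\mathcal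 R$ finite multiset of relational atoms, $\mathcal T$ of domain atoms, $\Gamma,\Delta$ of labeled formulae) with (1) if $\mathcal R\ne\emptyset$ every label in $\mathcal T,\Gamma,\Delta$ occurs in $\mathcal R$, and if $\mathcal R=\emptyset$ exactly one label occurs; (2) the directed graph of $\mathcal R$ connected without directed or undirected cycles. $w\twoheadrightarrow^*_{\mathcal R}u$ iff $w=u$ or there is a chain $wRv_1,\dots,v_nRu$ in $\mathcal R$. $X_w=\{x\mid u:x\in\mathcal T,\ u\twoheadrightarrow^*_{\mathcal R}w\}$; $t$ available for $w$ iff $t\in\mathrm{Ter}(X_w)$. Fresh = not occurring in the conclusion; side conditions evaluated in the conclusion. $\mathsf{LBIQ}(\mathrm{ID})$ (premises$\,/\,$conclusion, unchanged parts omitted): (ax) $\Gamma,w:p(\vec t)\vdash\Delta,u:p(\vec t)$ if $w\twoheadrightarrow^*_{\mathcal R}u$; $(\bot L)$ $\Gamma,w:\bot\vdash\Delta$; $(\top R)$ $\Gamma\vdash\Delta,w:\top$; $(\wedge L)$ $\Gamma,w:\varphi,w:\psi\vdash\Delta\,/\,\Gamma,w:\varphi\wedge\psi\vdash\Delta$; $(\wedge R)$ $\Gamma\vdash\Delta,w:\varphi$ and $\Gamma\vdash\Delta,w:\psi\,/\,\Gamma\vdash\Delta,w:\varphi\wedge\psi$; $(\vee L)$ $\Gamma,w:\varphi\vdash\Delta$ and $\Gamma,w:\psi\vdash\Delta\,/\,\Gamma,w:\varphi\vee\psi\vdash\Delta$; $(\vee R)$ $\Gamma\vdash\Delta,w:\varphi,w:\psi\,/\,\Gamma\vdash\Delta,w:\varphi\vee\psi$;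 $(\to L)$ $\Gamma,w:\varphi\to\psi\vdash\Delta,u:\varphi$ and $\Gamma,w:\varphi\to\psi,u:\psi\vdash\Delta\,/\,\Gamma,w:\varphi\to\psi\vdash\Delta$ if $w\twoheadrightarrow^*_{\mathcal R}u$; $(\to R)$ $\mathcal R,wRu,\mathcal T,\Gamma,u:\varphi\vdash\Delta,u:\psi\,/\,\mathcal R,\mathcal T,\Gamma\vdash\Delta,w:\varphi\to\psi$, $u$ fresh; $(\mathbin{ -\!\!<}L)$ $\mathcal R,uRw,\mathcal T,\Gamma,u:\varphi\vdash\Delta,u:\psi\,/\,\mathcal R,\mathcal T,\Gamma,w:\varphi\mathbin{ -\!\!<}\psi\vdash\Delta$, $u$ fresh; $(\mathbin{ -\!\!<}R)$ $\Gamma\vdash\Delta,u:\varphi\mathbin{ -\!\!<}\psi,w:\varphi$ and $\Gamma,w:\psi\vdash\Delta,u:\varphi\mathbin{ -\!\!<}\psi\,/\,\Gamma\vdash\Delta,u:\varphi\mathbin{ -\!\!<}\psi$ if $w\twoheadrightarrow^*_{\mathcal R}u$; $(\exists L)$ $\mathcal R,\mathcal T,w:y,\Gamma,w:\varphi(y/x)\vdash\Delta\,/\,\mathcal R,\mathcal T,\Gamma,w:\exists x\varphi\vdash\Delta$, $y$ fresh; $(\exists R)$ $\Gamma\vdash\Delta,w:\exists x\varphi,w:\varphi(t/x)\,/\,\Gamma\vdash\Delta,w:\exists x\varphi$ if $t$ available for $w$; $(\forall L)$ $\Gamma,w:\forall x\varphi,u:\varphi(t/x)\vdash\Delta\,/\,\Gamma,w:\forall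 x\varphi\vdash\Delta$ if $w\twoheadrightarrow^*_{\mathcal R}u$ and $t$ available for $u$; $(\forall R)$ $\mathcal R,wRu,\mathcal T,u:y,\Gamma\vdash\Delta,u:\varphi(y/x)\,/\,\mathcal R,\mathcal T,\Gamma\vdash\Delta,w:\forall x\varphi$, $u,y$ fresh; $(ds)$ $\mathcal R,\mathcal T,w:\mathrm{VT}(\vec t),\Gamma,w:p(\vec t)\vdash\Delta\,/\,\mathcal R,\mathcal T,\Gamma,w:p(\vec t)\vdash\Delta$. $\mathsf{LBIQ}(\mathrm{CD})$: remove $(ds)$, allow any $t\in\mathrm{Ter}$ in $(\exists R)$ and $(\forall L)$ (keeping $w\twoheadrightarrow^*_{\mathcal R}u$ in $(\forall L)$). Proofs are finite trees of rule instances with leaves (ax), $(\bot L)$, $(\top R)$; height = length of the longest branch. Sequents differing by a bijective label renaming are regarded as mutually derivable. -}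

module Defs where

open import Data.Nat using (ℕ; zero; suc; _≡ᵇ_; _⊔_; _≤_)
open import Data.Fin using (Fin; zero; suc)
open import Data.Bool using (if_then_else_)
open import Data.List using (List; []; _∷_; _++_; map; concatMap; filter)
open import Data.List.Membership.Propositional using (_∈_; _∉_)
open import Data.List.Relation.Unary.All using (All)
open import Data.List.Relation.Binary.Permutation.Propositional using (_↭_)
open import Data.Product using (Σ; ∃; _×_; _,_; proj₁; proj₂)
open import Data.Unit using (⊤)
open import Relation.Nullary using (¬_)
open import Relation.Binary.PropositionalEquality using (_≡_; _≢_)
open import Relation.Nullary.Decidable using (¬?)
open import Data.Nat using (_≟_)

Var : Set
Var = ℕ

Label : Set
Label = ℕ

-- Term n : terms with free (named) variables and n bound variables in scope.
-- A function symbol of arity k is a pair (name f, k); fn f args with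
-- length args = k.  Constants are fn c [].
data Term (n : ℕ) : Set where
  fv : Var → Term n
  bv : Fin n → Term n
  fn : ℕ → List (Term n) → Term n

-- Formulae with n bound variables in scope; genuine formulae are Formula 0.
data Formula (n : ℕ) : Set where
  atom  : ℕ → List (Term n) → Formula n
  fbot  : Formula n
  ftop  : Formula n
  _∧ᶠ_  : Formula n → Formula n → Formula n
  _∨ᶠ_  : Formula n → Formula n → Formula n
  _-<_  : Formula n → Formula n → Formula n
  _⇒_   : Formula n → Formula n → Formula n
  ∃ᶠ    : Formula (suc n) → Formula n
  ∀ᶠ    : Formula (suc n) → Formula n

mutual
  ren-t : ∀ {m k} → (Fin m → Fin k) → Term m → Term k
  ren-t ρ (fv x) = fv x
  ren-t ρ (bv i) = bv (ρ i)
  ren-t ρ (fn f ts) = fn f (ren-ts ρ ts)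

  ren-ts : ∀ {m k} → (Fin m → Fin k) → List (Term m) → List (Term k)
  ren-ts ρ [] = []
  ren-ts ρ (t ∷ ts) = ren-t ρ t ∷ ren-ts ρ ts

mutual
  sub-t : ∀ {m k} → (Fin m → Term k) → Term m → Term k
  sub-t σ (fv x) = fv x
  sub-t σ (bv i) = σ i
  sub-t σ (fn f ts) = fn f (sub-ts σ ts)

  sub-ts : ∀ {m k} → (Fin m → Term k) → List (Term m) → List (Term k)
  sub-ts σ [] = []
  sub-ts σ (t ∷ ts) = sub-t σ t ∷ sub-ts σ ts

lift : ∀ {m k} → (Fin m → Term k) → Fin (suc m) → Term (suc k)
lift σ zero = bv zero
lift σ (suc i) = ren-t suc (σ i)

subF : ∀ {m k} → (Fin m → Term k) → Formula m → Formula k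
subF σ (atom p ts) = atom p (sub-ts σ ts)
subF σ fbot = fbot
subF σ ftop = ftop
subF σ (φ ∧ᶠ ψ) = subF σ φ ∧ᶠ subF σ ψ
subF σ (φ ∨ᶠ ψ) = subF σ φ ∨ᶠ subF σ ψ
subF σ (φ -< ψ) = subF σ φ -< subF σ ψ
subF σ (φ ⇒ ψ) = subF σ φ ⇒ subF σ ψ
subF σ (∃ᶠ φ) = ∃ᶠ (subF (lift σ) φ)
subF σ (∀ᶠ φ) = ∀ᶠ (subF (lift σ) φ)

_⟨_⟩ : Formula 1 → Term 0 → Formula 0
φ ⟨ t ⟩ = subF (λ _ → t) φ

wk : ∀ {m} → Term 0 → Term m
wk = ren-t (λ ())

mutual
  fsub-t : ∀ {m} → Var → Term 0 → Term m → Term m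
  fsub-t x t (fv y) = if x ≡ᵇ y then wk t else fv y
  fsub-t x t (bv i) = bv i
  fsub-t x t (fn f ts) = fn f (fsub-ts x t ts)

  fsub-ts : ∀ {m} → Var → Term 0 → List (Term m) → List (Term m)
  fsub-ts x t [] = []
  fsub-ts x t (u ∷ us) = fsub-t x t u ∷ fsub-ts x t us

-- φ(t/x), capture-avoiding (bound variables are nameless)
fsubF : ∀ {m} → Var → Term 0 → Formula m → Formula m
fsubF x t (atom p ts) = atom p (fsub-ts x t ts)
fsubF x t fbot = fbot
fsubF x t ftop = ftop
fsubF x t (φ ∧ᶠ ψ) = fsubF x t φ ∧ᶠ fsubF x t ψ
fsubF x t (φ ∨ᶠ ψ) = fsubF x t φ ∨ᶠ fsubF x t ψ
fsubF x t (φ -< ψ) = fsubF x t φ -< fsubF x t ψ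
fsubF x t (φ ⇒ ψ) = fsubF x t φ ⇒ fsubF x t ψ
fsubF x t (∃ᶠ φ) = ∃ᶠ (fsubF x t φ)
fsubF x t (∀ᶠ φ) = ∀ᶠ (fsubF x t φ)

mutual
  VT : ∀ {m} → Term m → List Var
  VT (fv x) = x ∷ []
  VT (bv i) = []
  VT (fn f ts) = VTs ts

  VTs : ∀ {m} → List (Term m) → List Var
  VTs [] = []
  VTs (t ∷ ts) = VT t ++ VTs ts

FV : ∀ {m} → Formula m → List Var
FV (atom p ts) = VTs ts
FV fbot = []
FV ftop = []
FV (φ ∧ᶠ ψ) = FV φ ++ FV ψ
FV (φ ∨ᶠ ψ) = FV φ ++ FV ψ
FV (φ -< ψ) = FV φ ++ FV ψ
FV (φ ⇒ ψ) = FV φ ++ FV ψ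
FV (∃ᶠ φ) = FV φ
FV (∀ᶠ φ) = FV φ

-- Sequents  R, T, Γ ⊢ Δ  (multisets represented by lists)

RelAtom : Set
RelAtom = Label × Label          -- (w , u) is  wRu

DomAtom : Set
DomAtom = Label × Var            -- (w , x) is  w:x

LFormula : Set
LFormula = Label × Formula 0     -- (w , φ) is  w:φ

record Sequent : Set where
  constructor seq
  field
    R : List RelAtom
    T : List DomAtom
    Γ : List LFormula
    Δ : List LFormula
open Sequent public

labelsR : List RelAtom → List Label
labelsR = concatMap (λ p → proj₁ p ∷ proj₂ p ∷ [])

labelsO : Sequent → List Label
labelsO S = map proj₁ (T S) ++ map proj₁ (Γ S) ++ map proj₁ (Δ S)

labels : Sequent → List Label
labels S = labelsR (R S) ++ labelsO S

vars : Sequent → List Var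
vars S = map proj₂ (T S) ++ concatMap (λ p → FV (proj₂ p)) (Γ S)
                         ++ concatMap (λ p → FV (proj₂ p)) (Δ S)

FreshL : Label → Sequent → Set
FreshL u S = u ∉ labels S

FreshV : Var → Sequent → Set
FreshV y S = y ∉ vars S

data Reach (R : List RelAtom) : Label → Label → Set where
  here  : ∀ {w} → Reach R w w
  there : ∀ {w v u} → (w , v) ∈ R → Reach R v u → Reach R w u

data UPath (R : List RelAtom) : Label → Label → Set where
  here : ∀ {w} → UPath R w w
  fwd  : ∀ {w v u} → (w , v) ∈ R → UPath R v u → UPath R w u
  bwd  : ∀ {w v u} → (v , w) ∈ R → UPath R v u → UPath R w u

Connected : List RelAtom → Set
Connected R = ∀ a b → a ∈ labelsR R → b ∈ labelsR R → UPath R a b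

-- no (directed or undirected) cycles: no edge lies on an undirected cycle,
-- i.e. removing any one edge (occurrence) disconnects its endpoints
-- (this also excludes self-loops and repeated edges).
NoCycle : List RelAtom → Set
NoCycle R = ∀ R₁ R₂ a b → R ≡ R₁ ++ (a , b) ∷ R₂ → ¬ UPath (R₁ ++ R₂) a b

IsSequent : Sequent → Set
IsSequent S =
  (R S ≢ [] → All (λ w → w ∈ labelsR (R S)) (labelsO S)) ×
  (R S ≡ [] → ∃ λ w → w ∈ labelsO S × All (λ v → v ≡ w) (labelsO S)) ×
  Connected (R S) × NoCycle (R S)

substT : Var → Term 0 → List DomAtom → List DomAtom
substT x t T =
  filter (λ p → ¬? (proj₂ p ≟ x)) T ++
  concatMap (λ p → if proj₂ p ≡ᵇ x then map (λ y → proj₁ p , y) (VT t) else []) T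

substL : Var → Term 0 → List LFormula → List LFormula
substL x t = map (λ p → proj₁ p , fsubF x t (proj₂ p))

_[_/_]ˢ : Sequent → Term 0 → Var → Sequent
seq R T Γ Δ [ t / x ]ˢ = seq R (substT x t T) (substL x t Γ) (substL x t Δ)

data Calc : Set where
  ID CD : Calc

InX : List RelAtom → List DomAtom → Label → Var → Set
InX R T w x = ∃ λ u → (u , x) ∈ T × Reach R u w

Avail : Calc → List RelAtom → List DomAtom → Label → Term 0 → Set
Avail ID R T w t = All (InX R T w) (VT t)
Avail CD R T w t = ⊤

data Proof (C : Calc) : Sequent → Set where
  ax   : ∀ {R T Γ Δ w u p ts} → (w , atom p ts) ∈ Γ → (u , atom p ts) ∈ Δ →
         Reach R w u → Proof C (seq R T Γ Δ)
  botL : ∀ {R T Γ Δ w} → (w , fbot) ∈ Γ → Proof C (seq R T Γ Δ)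
  topR : ∀ {R T Γ Δ w} → (w , ftop) ∈ Δ → Proof C (seq R T Γ Δ)
  andL : ∀ {R T Γ Γ' Δ w φ ψ} → Γ ↭ (w , φ ∧ᶠ ψ) ∷ Γ' →
         Proof C (seq R T ((w , φ) ∷ (w , ψ) ∷ Γ') Δ) → Proof C (seq R T Γ Δ)
  andR : ∀ {R T Γ Δ Δ' w φ ψ} → Δ ↭ (w , φ ∧ᶠ ψ) ∷ Δ' →
         Proof C (seq R T Γ ((w , φ) ∷ Δ')) → Proof C (seq R T Γ ((w , ψ) ∷ Δ')) →
         Proof C (seq R T Γ Δ)
  orL  : ∀ {R T Γ Γ' Δ w φ ψ} → Γ ↭ (w , φ ∨ᶠ ψ) ∷ Γ' →
         Proof C (seq R T ((w , φ) ∷ Γ') Δ) → Proof C (seq R T ((w , ψ) ∷ Γ') Δ) →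
         Proof C (seq R T Γ Δ)
  orR  : ∀ {R T Γ Δ Δ' w φ ψ} → Δ ↭ (w , φ ∨ᶠ ψ) ∷ Δ' →
         Proof C (seq R T Γ ((w , φ) ∷ (w , ψ) ∷ Δ')) → Proof C (seq R T Γ Δ)
  impL : ∀ {R T Γ Δ w u φ ψ} → (w , φ ⇒ ψ) ∈ Γ → Reach R w u →
         Proof C (seq R T Γ ((u , φ) ∷ Δ)) → Proof C (seq R T ((u , ψ) ∷ Γ) Δ) →
         Proof C (seq R T Γ Δ)
  impR : ∀ {R T Γ Δ Δ' w u φ ψ} → Δ ↭ (w , φ ⇒ ψ) ∷ Δ' → FreshL u (seq R T Γ Δ) →
         Proof C (seq ((w , u) ∷ R) T ((u , φ) ∷ Γ) ((u , ψ) ∷ Δ')) →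
         Proof C (seq R T Γ Δ)
  excL : ∀ {R T Γ Γ' Δ w u φ ψ} → Γ ↭ (w , φ -< ψ) ∷ Γ' → FreshL u (seq R T Γ Δ) →
         Proof C (seq ((u , w) ∷ R) T ((u , φ) ∷ Γ') ((u , ψ) ∷ Δ)) →
         Proof C (seq R T Γ Δ)
  excR : ∀ {R T Γ Δ w u φ ψ} → (u , φ -< ψ) ∈ Δ → Reach R w u →
         Proof C (seq R T Γ ((w , φ) ∷ Δ)) → Proof C (seq R T ((w , ψ) ∷ Γ) Δ) →
         Proof C (seq R T Γ Δ)
  exL  : ∀ {R T Γ Γ' Δ w y φ} → Γ ↭ (w , ∃ᶠ φ) ∷ Γ' → FreshV y (seq R T Γ Δ) →
         Proof C (seq R ((w , y) ∷ T) ((w , φ ⟨ fv y ⟩) ∷ Γ') Δ) →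
         Proof C (seq R T Γ Δ)
  exR  : ∀ {R T Γ Δ w φ t} → (w , ∃ᶠ φ) ∈ Δ → Avail C R T w t →
         Proof C (seq R T Γ ((w , φ ⟨ t ⟩) ∷ Δ)) → Proof C (seq R T Γ Δ)
  allL : ∀ {R T Γ Δ w u φ t} → (w , ∀ᶠ φ) ∈ Γ → Reach R w u → Avail C R T u t →
         Proof C (seq R T ((u , φ ⟨ t ⟩) ∷ Γ) Δ) → Proof C (seq R T Γ Δ)
  allR : ∀ {R T Γ Δ Δ' w u y φ} → Δ ↭ (w , ∀ᶠ φ) ∷ Δ' →
         FreshL u (seq R T Γ Δ) → FreshV y (seq R T Γ Δ) →
         Proof C (seq ((w , u) ∷ R) ((u , y) ∷ T) Γ ((u , φ ⟨ fv y ⟩) ∷ Δ')) →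
         Proof C (seq R T Γ Δ)
  ds   : ∀ {R T Γ Δ w p ts} → C ≡ ID → (w , atom p ts) ∈ Γ →
         Proof C (seq R (map (λ y → w , y) (VTs ts) ++ T) Γ Δ) →
         Proof C (seq R T Γ Δ)

-- height = length of the longest branch (leaves have height 0)
height : ∀ {C S} → Proof C S → ℕ
height (ax _ _ _) = 0
height (botL _) = 0
height (topR _) = 0
height (andL _ p) = suc (height p)
height (andR _ p q) = suc (height p ⊔ height q)
height (orL _ p q) = suc (height p ⊔ height q)
height (orR _ p) = suc (height p)
height (impL _ _ p q) = suc (height p ⊔ height q)
height (impR _ _ p) = suc (height p)
height (excL _ _ p) = suc (height p)
height (excR _ _ p q) = suc (height p ⊔ height q)
height (exL _ _ p) = suc (height p)
height (exR _ _ p) = suc (height p)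
height (allL _ _ _ p) = suc (height p)
height (allR _ _ _ p) = suc (height p)
height (ds _ _ p) = suc (height p)

-- Substituting t for x commutes with
-- instantiating a quantifier, and it replaces a domain atom w:x by the atoms
-- w:y for the variables y of t, so every side condition (availability of
-- instantiation terms, freshness of labels) survives and each rule instance maps to an instance of the same
-- rule. The only obstacle is an eigenvariable y of (∃L) or (∀R) that clashes
-- with x or with a variable of t: there the premise is first renamed to a
-- variable z fresh for the substituted conclusion (the induction hypothesis
-- at a smaller height, with t := z) and then substituted. Since the induction
-- hypothesis is applied twice to one premise, the induction is on a bound on
-- the height rather than on the proof itself.
module Submission where

open import Defs
open import Data.Bool using (true; false; if_then_else_)
open import Data.Empty using (⊥-elim)
open import Data.Fin using (Fin; zero; suc)
open import Data.List using (List; []; _∷_; _++_; map; filter)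
open import Data.List.Extrema.Nat using (max; ⊥≤max; xs≤max)
open import Data.List.Membership.Propositional using (_∈_; _∉_; find; lose)
open import Data.List.Membership.Propositional.Properties
  using (∈-++⁺ˡ; ∈-++⁺ʳ; ∈-++⁻; ∈-map⁺; ∈-map⁻; ∈-filter⁺; ∈-filter⁻; ∈-concatMap⁺; ∈-concatMap⁻)
open import Data.List.Properties using (map-∘)
open import Data.List.Relation.Binary.Permutation.Propositional using (_↭_)
open import Data.List.Relation.Binary.Permutation.Propositional.Properties
  using (All-resp-↭) renaming (map⁺ to ↭-map⁺)
open import Data.List.Relation.Binary.Subset.Propositional using (_⊆_)
open import Data.List.Relation.Binary.Subset.Propositional.Properties
  using (⊆-reflexive; ++⁺; ++⁺ˡ; ++⁺ʳ; ∷⁺ʳ) renaming (map⁺ to ⊆-map⁺)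
open import Data.List.Relation.Unary.All as All using (All; []; _∷_)
open import Data.List.Relation.Unary.Any using (here; there)
open import Data.Nat using (ℕ; suc; _≡ᵇ_; _⊔_; _≤_; s≤s; z≤n; _≟_)
open import Data.Nat.Properties using (≤-refl; ≤-trans; ⊔-mono-≤; m⊔n≤o⇒m≤o; m⊔n≤o⇒n≤o; n≮n)
open import Data.Product using (Σ; ∃; _×_; _,_; proj₁; proj₂)
open import Data.Sum using (_⊎_; inj₁; inj₂)
open import Data.Unit using (tt)
open import Function using (_∘_)
open import Relation.Nullary using (Dec)
open import Relation.Nullary.Decidable using (¬?)
open import Relation.Nullary.Reflects using (Reflects; ofʸ; ofⁿ)
open import Relation.Binary.PropositionalEquality
  using (_≡_; _≢_; refl; sym; trans; cong; cong₂; subst; module ≡-Reasoning)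

-- fsub-t and substT test variables with _≡ᵇ_; _≟_ on ℕ is implemented by the same test.
≡ᵇ-reflects : ∀ m n → Reflects (m ≡ n) (m ≡ᵇ n)
≡ᵇ-reflects m n = Dec.proof (m ≟ n)

mutual
  ren-t-closed : ∀ {m k} (ρ : Fin m → Fin k) (ρ₀ : Fin 0 → Fin m) (ρ₁ : Fin 0 → Fin k) (t : Term 0) →
                 ren-t ρ (ren-t ρ₀ t) ≡ ren-t ρ₁ t
  ren-t-closed ρ ρ₀ ρ₁ (fv x) = refl
  ren-t-closed ρ ρ₀ ρ₁ (fn f ts) = cong (fn f) (ren-ts-closed ρ ρ₀ ρ₁ ts)

  ren-ts-closed : ∀ {m k} (ρ : Fin m → Fin k) (ρ₀ : Fin 0 → Fin m) (ρ₁ : Fin 0 → Fin k) (ts : List (Term 0)) →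
                  ren-ts ρ (ren-ts ρ₀ ts) ≡ ren-ts ρ₁ ts
  ren-ts-closed ρ ρ₀ ρ₁ [] = refl
  ren-ts-closed ρ ρ₀ ρ₁ (t ∷ ts) = cong₂ _∷_ (ren-t-closed ρ ρ₀ ρ₁ t) (ren-ts-closed ρ ρ₀ ρ₁ ts)

mutual
  sub-t-closed : ∀ {m k} (σ : Fin m → Term k) (ρ₀ : Fin 0 → Fin m) (ρ₁ : Fin 0 → Fin k) (t : Term 0) →
                 sub-t σ (ren-t ρ₀ t) ≡ ren-t ρ₁ t
  sub-t-closed σ ρ₀ ρ₁ (fv x) = refl
  sub-t-closed σ ρ₀ ρ₁ (fn f ts) = cong (fn f) (sub-ts-closed σ ρ₀ ρ₁ ts)

  sub-ts-closed : ∀ {m k} (σ : Fin m → Term k) (ρ₀ : Fin 0 → Fin m) (ρ₁ : Fin 0 → Fin k) (ts : List (Term 0)) →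
                  sub-ts σ (ren-ts ρ₀ ts) ≡ ren-ts ρ₁ ts
  sub-ts-closed σ ρ₀ ρ₁ [] = refl
  sub-ts-closed σ ρ₀ ρ₁ (t ∷ ts) = cong₂ _∷_ (sub-t-closed σ ρ₀ ρ₁ t) (sub-ts-closed σ ρ₀ ρ₁ ts)

ren-t-wk : ∀ {m k} (ρ : Fin m → Fin k) (t : Term 0) → ren-t ρ (wk {m} t) ≡ wk t
ren-t-wk ρ = ren-t-closed ρ _ _

sub-t-wk : ∀ {m k} (σ : Fin m → Term k) (t : Term 0) → sub-t σ (wk {m} t) ≡ wk t
sub-t-wk σ = sub-t-closed σ _ _

mutual
  VT-ren-t : ∀ {m k} (ρ : Fin m → Fin k) (u : Term m) → VT (ren-t ρ u) ≡ VT u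
  VT-ren-t ρ (fv x) = refl
  VT-ren-t ρ (bv i) = refl
  VT-ren-t ρ (fn f ts) = VTs-ren-ts ρ ts

  VTs-ren-ts : ∀ {m k} (ρ : Fin m → Fin k) (us : List (Term m)) → VTs (ren-ts ρ us) ≡ VTs us
  VTs-ren-ts ρ [] = refl
  VTs-ren-ts ρ (u ∷ us) = cong₂ _++_ (VT-ren-t ρ u) (VTs-ren-ts ρ us)

VT-wk : ∀ {m} (t : Term 0) → VT (wk {m} t) ≡ VT t
VT-wk = VT-ren-t _

fsub-t-self : ∀ {m} x t → fsub-t {m} x t (fv x) ≡ wk t
fsub-t-self x t with x ≡ᵇ x | ≡ᵇ-reflects x x
... | true  | _       = refl
... | false | ofⁿ x≢x = ⊥-elim (x≢x refl)

fsub-t-other : ∀ {m} x t {y} → x ≢ y → fsub-t {m} x t (fv y) ≡ fv y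
fsub-t-other x t {y} x≢y with x ≡ᵇ y | ≡ᵇ-reflects x y
... | true  | ofʸ x≡y = ⊥-elim (x≢y x≡y)
... | false | _       = refl

mutual
  fsub-t-ren-t : ∀ {m k} x t (ρ : Fin m → Fin k) (u : Term m) →
                 fsub-t x t (ren-t ρ u) ≡ ren-t ρ (fsub-t x t u)
  fsub-t-ren-t x t ρ (fv y) with x ≡ᵇ y
  ... | true  = sym (ren-t-wk ρ t)
  ... | false = refl
  fsub-t-ren-t x t ρ (bv i) = refl
  fsub-t-ren-t x t ρ (fn f ts) = cong (fn f) (fsub-ts-ren-ts x t ρ ts)

  fsub-ts-ren-ts : ∀ {m k} x t (ρ : Fin m → Fin k) (us : List (Term m)) →
                   fsub-ts x t (ren-ts ρ us) ≡ ren-ts ρ (fsub-ts x t us)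
  fsub-ts-ren-ts x t ρ [] = refl
  fsub-ts-ren-ts x t ρ (u ∷ us) = cong₂ _∷_ (fsub-t-ren-t x t ρ u) (fsub-ts-ren-ts x t ρ us)

mutual
  fsub-t-sub-t : ∀ {m k} x t (σ : Fin m → Term k) (u : Term m) →
                 fsub-t x t (sub-t σ u) ≡ sub-t (fsub-t x t ∘ σ) (fsub-t x t u)
  fsub-t-sub-t x t σ (fv y) with x ≡ᵇ y
  ... | true  = sym (sub-t-wk _ t)
  ... | false = refl
  fsub-t-sub-t x t σ (bv i) = refl
  fsub-t-sub-t x t σ (fn f ts) = cong (fn f) (fsub-ts-sub-ts x t σ ts)

  fsub-ts-sub-ts : ∀ {m k} x t (σ : Fin m → Term k) (us : List (Term m)) →
                   fsub-ts x t (sub-ts σ us) ≡ sub-ts (fsub-t x t ∘ σ) (fsub-ts x t us)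
  fsub-ts-sub-ts x t σ [] = refl
  fsub-ts-sub-ts x t σ (u ∷ us) = cong₂ _∷_ (fsub-t-sub-t x t σ u) (fsub-ts-sub-ts x t σ us)

mutual
  sub-t-cong : ∀ {m k} {σ τ : Fin m → Term k} → (∀ i → σ i ≡ τ i) → ∀ u → sub-t σ u ≡ sub-t τ u
  sub-t-cong σ≗τ (fv x) = refl
  sub-t-cong σ≗τ (bv i) = σ≗τ i
  sub-t-cong σ≗τ (fn f ts) = cong (fn f) (sub-ts-cong σ≗τ ts)

  sub-ts-cong : ∀ {m k} {σ τ : Fin m → Term k} → (∀ i → σ i ≡ τ i) → ∀ us → sub-ts σ us ≡ sub-ts τ us
  sub-ts-cong σ≗τ [] = refl
  sub-ts-cong σ≗τ (u ∷ us) = cong₂ _∷_ (sub-t-cong σ≗τ u) (sub-ts-cong σ≗τ us)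

lift-cong : ∀ {m k} {σ τ : Fin m → Term k} → (∀ i → σ i ≡ τ i) → ∀ i → lift σ i ≡ lift τ i
lift-cong σ≗τ zero = refl
lift-cong σ≗τ (suc i) = cong (ren-t suc) (σ≗τ i)

subF-cong : ∀ {m k} {σ τ : Fin m → Term k} → (∀ i → σ i ≡ τ i) → ∀ φ → subF σ φ ≡ subF τ φ
subF-cong σ≗τ (atom p ts) = cong (atom p) (sub-ts-cong σ≗τ ts)
subF-cong σ≗τ fbot = refl
subF-cong σ≗τ ftop = refl
subF-cong σ≗τ (φ ∧ᶠ ψ) = cong₂ _∧ᶠ_ (subF-cong σ≗τ φ) (subF-cong σ≗τ ψ)
subF-cong σ≗τ (φ ∨ᶠ ψ) = cong₂ _∨ᶠ_ (subF-cong σ≗τ φ) (subF-cong σ≗τ ψ)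
subF-cong σ≗τ (φ -< ψ) = cong₂ _-<_ (subF-cong σ≗τ φ) (subF-cong σ≗τ ψ)
subF-cong σ≗τ (φ ⇒ ψ) = cong₂ _⇒_ (subF-cong σ≗τ φ) (subF-cong σ≗τ ψ)
subF-cong σ≗τ (∃ᶠ φ) = cong ∃ᶠ (subF-cong (lift-cong σ≗τ) φ)
subF-cong σ≗τ (∀ᶠ φ) = cong ∀ᶠ (subF-cong (lift-cong σ≗τ) φ)

fsub-t-lift : ∀ {m k} x t (σ : Fin m → Term k) i →
              fsub-t x t (lift σ i) ≡ lift (fsub-t x t ∘ σ) i
fsub-t-lift x t σ zero = refl
fsub-t-lift x t σ (suc i) = fsub-t-ren-t x t suc (σ i)

fsubF-subF : ∀ {m k} x t (σ : Fin m → Term k) φ →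
             fsubF x t (subF σ φ) ≡ subF (fsub-t x t ∘ σ) (fsubF x t φ)
fsubF-subF x t σ (atom p ts) = cong (atom p) (fsub-ts-sub-ts x t σ ts)
fsubF-subF x t σ fbot = refl
fsubF-subF x t σ ftop = refl
fsubF-subF x t σ (φ ∧ᶠ ψ) = cong₂ _∧ᶠ_ (fsubF-subF x t σ φ) (fsubF-subF x t σ ψ)
fsubF-subF x t σ (φ ∨ᶠ ψ) = cong₂ _∨ᶠ_ (fsubF-subF x t σ φ) (fsubF-subF x t σ ψ)
fsubF-subF x t σ (φ -< ψ) = cong₂ _-<_ (fsubF-subF x t σ φ) (fsubF-subF x t σ ψ)
fsubF-subF x t σ (φ ⇒ ψ) = cong₂ _⇒_ (fsubF-subF x t σ φ) (fsubF-subF x t σ ψ)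
fsubF-subF x t σ (∃ᶠ φ) = cong ∃ᶠ (trans (fsubF-subF x t (lift σ) φ) (subF-cong (fsub-t-lift x t σ) _))
fsubF-subF x t σ (∀ᶠ φ) = cong ∀ᶠ (trans (fsubF-subF x t (lift σ) φ) (subF-cong (fsub-t-lift x t σ) _))

fsubF-⟨⟩ : ∀ x t (φ : Formula 1) s → fsubF x t (φ ⟨ s ⟩) ≡ fsubF x t φ ⟨ fsub-t x t s ⟩
fsubF-⟨⟩ x t φ s = fsubF-subF x t (λ _ → s) φ

mutual
  fsub-t-fresh : ∀ {m} y s (u : Term m) → y ∉ VT u → fsub-t y s u ≡ u
  fsub-t-fresh y s (fv z) y∉ = fsub-t-other y s (y∉ ∘ here)
  fsub-t-fresh y s (bv i) y∉ = refl
  fsub-t-fresh y s (fn f ts) y∉ = cong (fn f) (fsub-ts-fresh y s ts y∉)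

  fsub-ts-fresh : ∀ {m} y s (us : List (Term m)) → y ∉ VTs us → fsub-ts y s us ≡ us
  fsub-ts-fresh y s [] y∉ = refl
  fsub-ts-fresh y s (u ∷ us) y∉ =
    cong₂ _∷_ (fsub-t-fresh y s u (y∉ ∘ ∈-++⁺ˡ)) (fsub-ts-fresh y s us (y∉ ∘ ∈-++⁺ʳ (VT u)))

fsubF-fresh : ∀ {m} y s (φ : Formula m) → y ∉ FV φ → fsubF y s φ ≡ φ
fsubF-fresh y s (atom p ts) y∉ = cong (atom p) (fsub-ts-fresh y s ts y∉)
fsubF-fresh y s fbot y∉ = refl
fsubF-fresh y s ftop y∉ = refl
fsubF-fresh y s (φ ∧ᶠ ψ) y∉ = cong₂ _∧ᶠ_ (fsubF-fresh y s φ (y∉ ∘ ∈-++⁺ˡ)) (fsubF-fresh y s ψ (y∉ ∘ ∈-++⁺ʳ (FV φ)))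
fsubF-fresh y s (φ ∨ᶠ ψ) y∉ = cong₂ _∨ᶠ_ (fsubF-fresh y s φ (y∉ ∘ ∈-++⁺ˡ)) (fsubF-fresh y s ψ (y∉ ∘ ∈-++⁺ʳ (FV φ)))
fsubF-fresh y s (φ -< ψ) y∉ = cong₂ _-<_ (fsubF-fresh y s φ (y∉ ∘ ∈-++⁺ˡ)) (fsubF-fresh y s ψ (y∉ ∘ ∈-++⁺ʳ (FV φ)))
fsubF-fresh y s (φ ⇒ ψ) y∉ = cong₂ _⇒_ (fsubF-fresh y s φ (y∉ ∘ ∈-++⁺ˡ)) (fsubF-fresh y s ψ (y∉ ∘ ∈-++⁺ʳ (FV φ)))
fsubF-fresh y s (∃ᶠ φ) y∉ = cong ∃ᶠ (fsubF-fresh y s φ y∉)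
fsubF-fresh y s (∀ᶠ φ) y∉ = cong ∀ᶠ (fsubF-fresh y s φ y∉)

fsubF-rename-⟨⟩ : ∀ x t y z (φ : Formula 1) → y ∉ FV φ → x ≢ z →
                  fsubF x t (fsubF y (fv z) (φ ⟨ fv y ⟩)) ≡ fsubF x t φ ⟨ fv z ⟩
fsubF-rename-⟨⟩ x t y z φ y∉φ x≢z = begin
  fsubF x t (fsubF y (fv z) (φ ⟨ fv y ⟩))
    ≡⟨ cong (fsubF x t) (fsubF-⟨⟩ y (fv z) φ (fv y)) ⟩
  fsubF x t (fsubF y (fv z) φ ⟨ fsub-t y (fv z) (fv y) ⟩)
    ≡⟨ cong₂ (λ ψ s → fsubF x t (ψ ⟨ s ⟩)) (fsubF-fresh y (fv z) φ y∉φ) (fsub-t-self y (fv z)) ⟩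
  fsubF x t (φ ⟨ fv z ⟩)
    ≡⟨ fsubF-⟨⟩ x t φ (fv z) ⟩
  fsubF x t φ ⟨ fsub-t x t (fv z) ⟩
    ≡⟨ cong (fsubF x t φ ⟨_⟩) (fsub-t-other x t x≢z) ⟩
  fsubF x t φ ⟨ fv z ⟩ ∎
  where open ≡-Reasoning

-- SubstVar P t x v: v is a variable of E(t/x), where P holds of the variables of E.
data SubstVar (P : Var → Set) (t : Term 0) (x : Var) (v : Var) : Set where
  kept     : P v → v ≢ x → SubstVar P t x v
  replaced : P x → v ∈ VT t → SubstVar P t x v

SubstVar-map : ∀ {P Q : Var → Set} {t x v} → (∀ {u} → P u → Q u) → SubstVar P t x v → SubstVar Q t x v
SubstVar-map f (kept p v≢x) = kept (f p) v≢x
SubstVar-map f (replaced p v∈t) = replaced (f p) v∈t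

SubstVar-⊎ : ∀ {P Q : Var → Set} {t x v} →
             SubstVar (λ u → P u ⊎ Q u) t x v → SubstVar P t x v ⊎ SubstVar Q t x v
SubstVar-⊎ (kept (inj₁ p) v≢x) = inj₁ (kept p v≢x)
SubstVar-⊎ (kept (inj₂ q) v≢x) = inj₂ (kept q v≢x)
SubstVar-⊎ (replaced (inj₁ p) v∈t) = inj₁ (replaced p v∈t)
SubstVar-⊎ (replaced (inj₂ q) v∈t) = inj₂ (replaced q v∈t)

mutual
  ∈-VT-fsub⁻ : ∀ {m} x t (u : Term m) {v} → v ∈ VT (fsub-t x t u) → SubstVar (_∈ VT u) t x v
  ∈-VT-fsub⁻ x t (fv y) {v} v∈ with x ≡ᵇ y | ≡ᵇ-reflects x y
  ∈-VT-fsub⁻ x t (fv y) {v} v∈         | true  | ofʸ refl = replaced (here refl) (subst (v ∈_) (VT-wk t) v∈)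
  ∈-VT-fsub⁻ x t (fv y) (here refl)    | false | ofⁿ x≢y  = kept (here refl) (x≢y ∘ sym)
  ∈-VT-fsub⁻ x t (fn f ts) v∈ = ∈-VTs-fsub⁻ x t ts v∈

  ∈-VTs-fsub⁻ : ∀ {m} x t (us : List (Term m)) {v} → v ∈ VTs (fsub-ts x t us) → SubstVar (_∈ VTs us) t x v
  ∈-VTs-fsub⁻ x t (u ∷ us) v∈ with ∈-++⁻ (VT (fsub-t x t u)) v∈
  ... | inj₁ v∈u  = SubstVar-map ∈-++⁺ˡ (∈-VT-fsub⁻ x t u v∈u)
  ... | inj₂ v∈us = SubstVar-map (∈-++⁺ʳ (VT u)) (∈-VTs-fsub⁻ x t us v∈us)

mutual
  ∈-VT-fsub⁺ : ∀ {m} x t (u : Term m) {v} → SubstVar (_∈ VT u) t x v → v ∈ VT (fsub-t x t u)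
  ∈-VT-fsub⁺ {m} x t (fv y) (kept (here refl) y≢x) rewrite fsub-t-other {m} x t (y≢x ∘ sym) = here refl
  ∈-VT-fsub⁺ {m} x t (fv x) (replaced (here refl) v∈t) rewrite fsub-t-self {m} x t | VT-wk {m} t = v∈t
  ∈-VT-fsub⁺ x t (fn f ts) s = ∈-VTs-fsub⁺ x t ts s

  ∈-VTs-fsub⁺ : ∀ {m} x t (us : List (Term m)) {v} → SubstVar (_∈ VTs us) t x v → v ∈ VTs (fsub-ts x t us)
  ∈-VTs-fsub⁺ x t [] (kept () _)
  ∈-VTs-fsub⁺ x t [] (replaced () _)
  ∈-VTs-fsub⁺ x t (u ∷ us) s with SubstVar-⊎ (SubstVar-map (∈-++⁻ (VT u)) s)
  ... | inj₁ su  = ∈-++⁺ˡ (∈-VT-fsub⁺ x t u su)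
  ... | inj₂ sus = ∈-++⁺ʳ (VT (fsub-t x t u)) (∈-VTs-fsub⁺ x t us sus)

replacement : Var → Term 0 → DomAtom → List DomAtom
replacement x t p = if proj₂ p ≡ᵇ x then map (proj₁ p ,_) (VT t) else []

∈-replacement-self : ∀ x t {l v} → v ∈ VT t → (l , v) ∈ replacement x t (l , x)
∈-replacement-self x t {l} v∈t with x ≡ᵇ x | ≡ᵇ-reflects x x
... | true  | _       = ∈-map⁺ (l ,_) v∈t
... | false | ofⁿ x≢x = ⊥-elim (x≢x refl)

∈-substT⁻ : ∀ x t T {l v} → (l , v) ∈ substT x t T → SubstVar (λ u → (l , u) ∈ T) t x v
∈-substT⁻ x t T lv∈ with ∈-++⁻ (filter (λ p → ¬? (proj₂ p ≟ x)) T) lv∈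
... | inj₁ kept∈ = let lv∈T , v≢x = ∈-filter⁻ (λ p → ¬? (proj₂ p ≟ x)) kept∈ in kept lv∈T v≢x
... | inj₂ replaced∈ = from-replacement (find (∈-concatMap⁻ (replacement x t) replaced∈))
  where
  from-replacement : ∀ {l v} → ∃ (λ p → p ∈ T × (l , v) ∈ replacement x t p) →
                     SubstVar (λ u → (l , u) ∈ T) t x v
  from-replacement ((l′ , y) , p∈ , lv∈p) with y ≡ᵇ x | ≡ᵇ-reflects y x
  ... | true  | ofʸ refl with ∈-map⁻ (l′ ,_) lv∈p
  ...   | _ , v∈t , refl = replaced p∈ v∈t
  from-replacement (_ , _ , ()) | false | _

∈-substT⁺ : ∀ x t T {l v} → SubstVar (λ u → (l , u) ∈ T) t x v → (l , v) ∈ substT x t T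
∈-substT⁺ x t T (kept lv∈ v≢x) = ∈-++⁺ˡ (∈-filter⁺ (λ p → ¬? (proj₂ p ≟ x)) lv∈ v≢x)
∈-substT⁺ x t T (replaced lx∈ v∈t) =
  ∈-++⁺ʳ (filter (λ p → ¬? (proj₂ p ≟ x)) T)
         (∈-concatMap⁺ (replacement x t) (lose lx∈ (∈-replacement-self x t v∈t)))

labels-substT : ∀ x t T → map proj₁ (substT x t T) ⊆ map proj₁ T
labels-substT x t T l∈ with ∈-map⁻ proj₁ l∈
... | _ , lv∈ , refl with ∈-substT⁻ x t T lv∈
...   | kept lv∈T _     = ∈-map⁺ proj₁ lv∈T
...   | replaced lx∈T _ = ∈-map⁺ proj₁ lx∈T

InX-substT : ∀ {R T w x t v} → SubstVar (InX R T w) t x v → InX R (substT x t T) w v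
InX-substT {T = T} {x = x} {t} (kept (u , uv∈ , u↠w) v≢x) = u , ∈-substT⁺ x t T (kept uv∈ v≢x) , u↠w
InX-substT {T = T} {x = x} {t} (replaced (u , ux∈ , u↠w) v∈t) = u , ∈-substT⁺ x t T (replaced ux∈ v∈t) , u↠w

Avail-substT : ∀ {C R T w} x t s → Avail C R T w s → Avail C R (substT x t T) w (fsub-t x t s)
Avail-substT {ID} x t s s-avail =
  All.tabulate (InX-substT ∘ SubstVar-map (All.lookup s-avail) ∘ ∈-VT-fsub⁻ x t s)
Avail-substT {CD} _ _ _ _ = tt

Avail-⊆ : ∀ {C R T T′ w s} → T ⊆ T′ → Avail C R T w s → Avail C R T′ w s
Avail-⊆ {ID} T⊆T′ = All.map λ (u , uv∈ , u↠w) → u , T⊆T′ uv∈ , u↠w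
Avail-⊆ {CD} _ _ = tt

substLF : Var → Term 0 → LFormula → LFormula
substLF x t p = proj₁ p , fsubF x t (proj₂ p)

labels-substL : ∀ x t Γ → map proj₁ (substL x t Γ) ≡ map proj₁ Γ
labels-substL x t Γ = sym (map-∘ Γ)

FreshL-⊆ : ∀ {u R T T′ Γ Γ′ Δ Δ′} → map proj₁ T′ ⊆ map proj₁ T →
           map proj₁ Γ′ ≡ map proj₁ Γ → map proj₁ Δ′ ≡ map proj₁ Δ →
           FreshL u (seq R T Γ Δ) → FreshL u (seq R T′ Γ′ Δ′)
FreshL-⊆ {R = R} T′⊆T Γ′≡Γ Δ′≡Δ u∉ =
  u∉ ∘ ++⁺ʳ (labelsR R) (++⁺ T′⊆T (++⁺ (⊆-reflexive Γ′≡Γ) (⊆-reflexive Δ′≡Δ)))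

FreshL-substT : ∀ {u} S x t → FreshL u S → FreshL u (S [ t / x ]ˢ)
FreshL-substT (seq R T Γ Δ) x t =
  FreshL-⊆ {R = R} (labels-substT x t T) (labels-substL x t Γ) (labels-substL x t Δ)

FreshL-T : ∀ {u} R {T T′} Γ Δ → T′ ⊆ T → FreshL u (seq R T Γ Δ) → FreshL u (seq R T′ Γ Δ)
FreshL-T R Γ Δ T′⊆T = FreshL-⊆ {R = R} {Γ = Γ} {Δ = Δ} (⊆-map⁺ proj₁ T′⊆T) refl refl

FreshV-T : ∀ {y} R {T T′} Γ Δ → T′ ⊆ T → FreshV y (seq R T Γ Δ) → FreshV y (seq R T′ Γ Δ)
FreshV-T R Γ Δ T′⊆T y∉ = y∉ ∘ ++⁺ˡ _ (⊆-map⁺ proj₂ T′⊆T)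

freshVar : (x : Var) (vs : List Var) → Σ Var λ z → z ∉ vs × x ≢ z
freshVar x vs = suc m , (n≮n m ∘ All.lookup (xs≤max x vs)) , (λ x≡ → n≮n m (subst (_≤ m) x≡ (⊥≤max x vs)))
  where m = max x vs

_∉FV_ : Var → List LFormula → Set
y ∉FV Γ = All (λ p → y ∉ FV (proj₂ p)) Γ

FreshV-split : ∀ {y} S → FreshV y S → y ∉ map proj₂ (T S) × y ∉FV Γ S × y ∉FV Δ S
FreshV-split (seq R T Γ Δ) y∉ =
  y∉ ∘ ∈-++⁺ˡ ,
  All.tabulate (λ p∈ → y∉ ∘ ∈-++⁺ʳ (map proj₂ T) ∘ ∈-++⁺ˡ ∘ ∈-concatMap⁺ (FV ∘ proj₂) ∘ lose p∈) ,
  All.tabulate (λ p∈ → y∉ ∘ ∈-++⁺ʳ (map proj₂ T) ∘ ∈-++⁺ʳ _ ∘ ∈-concatMap⁺ (FV ∘ proj₂) ∘ lose p∈)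

substL-fresh : ∀ {y} s {Γ} → y ∉FV Γ → substL y s Γ ≡ Γ
substL-fresh s [] = refl
substL-fresh s {(w , φ) ∷ Γ} (y∉φ ∷ y∉Γ) = cong₂ _∷_ (cong (w ,_) (fsubF-fresh _ s φ y∉φ)) (substL-fresh s y∉Γ)

substL-rename-⟨⟩ : ∀ x t y z w (φ : Formula 1) {Γ} → y ∉ FV φ → y ∉FV Γ → x ≢ z →
                   substL x t (substL y (fv z) ((w , φ ⟨ fv y ⟩) ∷ Γ)) ≡ (w , fsubF x t φ ⟨ fv z ⟩) ∷ substL x t Γ
substL-rename-⟨⟩ x t y z w φ y∉φ y∉Γ x≢z =
  cong₂ _∷_ (cong (w ,_) (fsubF-rename-⟨⟩ x t y z φ y∉φ x≢z)) (cong (substL x t) (substL-fresh (fv z) y∉Γ))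

∉-map-proj₂ : ∀ {y l v} {T : List DomAtom} → y ∉ map proj₂ T → (l , v) ∈ T → v ≢ y
∉-map-proj₂ y∉T lv∈T refl = y∉T (∈-map⁺ proj₂ lv∈T)

substT-rename⊆ : ∀ x t y z l T → y ∉ map proj₂ T → x ≢ z →
                 substT x t (substT y (fv z) ((l , y) ∷ T)) ⊆ (l , z) ∷ substT x t T
substT-rename⊆ x t y z l T y∉T x≢z {l′ , v} lv∈ with ∈-substT⁻ x t _ lv∈
... | kept lv∈′ v≢x with ∈-substT⁻ y (fv z) ((l , y) ∷ T) lv∈′
...   | kept (here refl) v≢y          = ⊥-elim (v≢y refl)
...   | kept (there lv∈T) _           = there (∈-substT⁺ x t T (kept lv∈T v≢x))
...   | replaced (here refl) (here refl) = here refl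
...   | replaced (there ly∈T) _       = ⊥-elim (∉-map-proj₂ y∉T ly∈T refl)
substT-rename⊆ x t y z l T y∉T x≢z {l′ , v} lv∈ | replaced lx∈′ v∈t with ∈-substT⁻ y (fv z) ((l , y) ∷ T) lx∈′
...   | kept (here refl) x≢y     = ⊥-elim (x≢y refl)
...   | kept (there lx∈T) _      = there (∈-substT⁺ x t T (replaced lx∈T v∈t))
...   | replaced _ (here x≡z)    = ⊥-elim (x≢z x≡z)

substT-rename⊇ : ∀ x t y z l T → y ∉ map proj₂ T → x ≢ z →
                 (l , z) ∷ substT x t T ⊆ substT x t (substT y (fv z) ((l , y) ∷ T))
substT-rename⊇ x t y z l T y∉T x≢z {_ , _} lv∈ = ∈-substT⁺ x t (substT y (fv z) ((l , y) ∷ T)) (renamed lv∈)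
  where
  renamed : ∀ {l′ v} → (l′ , v) ∈ (l , z) ∷ substT x t T →
            SubstVar (λ u → (l′ , u) ∈ substT y (fv z) ((l , y) ∷ T)) t x v
  renamed (here refl) = kept (∈-substT⁺ y (fv z) ((l , y) ∷ T) (replaced (here refl) (here refl))) (x≢z ∘ sym)
  renamed (there lv∈) with ∈-substT⁻ x t T lv∈
  ... | kept lv∈T v≢x     = kept (∈-substT⁺ y (fv z) ((l , y) ∷ T) (kept (there lv∈T) (∉-map-proj₂ y∉T lv∈T))) v≢x
  ... | replaced lx∈T v∈t = replaced (∈-substT⁺ y (fv z) ((l , y) ∷ T) (kept (there lx∈T) (∉-map-proj₂ y∉T lx∈T))) v∈t

atoms : Label → List Var → List DomAtom
atoms w = map (λ y → w , y)

∈-atoms-fsub⁺ : ∀ {l v} x t w (ts : List (Term 0)) →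
                SubstVar (λ u → (l , u) ∈ atoms w (VTs ts)) t x v → (l , v) ∈ atoms w (VTs (fsub-ts x t ts))
∈-atoms-fsub⁺ x t w ts (kept lv∈ v≢x) with ∈-map⁻ (λ y → w , y) lv∈
... | _ , v∈ , refl = ∈-map⁺ (λ y → w , y) (∈-VTs-fsub⁺ x t ts (kept v∈ v≢x))
∈-atoms-fsub⁺ x t w ts (replaced lx∈ v∈t) with ∈-map⁻ (λ y → w , y) lx∈
... | _ , x∈ , refl = ∈-map⁺ (λ y → w , y) (∈-VTs-fsub⁺ x t ts (replaced x∈ v∈t))

substT-ds⊆ : ∀ x t w (ts : List (Term 0)) T →
             substT x t (atoms w (VTs ts) ++ T) ⊆ atoms w (VTs (fsub-ts x t ts)) ++ substT x t T
substT-ds⊆ x t w ts T lv∈ with SubstVar-⊎ (SubstVar-map (∈-++⁻ (atoms w (VTs ts))) (∈-substT⁻ x t _ lv∈))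
... | inj₁ inM = ∈-++⁺ˡ (∈-atoms-fsub⁺ x t w ts inM)
... | inj₂ inT = ∈-++⁺ʳ (atoms w (VTs (fsub-ts x t ts))) (∈-substT⁺ x t T inT)

substT-ds⊇ : ∀ x t w (ts : List (Term 0)) T →
             atoms w (VTs (fsub-ts x t ts)) ++ substT x t T ⊆ substT x t (atoms w (VTs ts) ++ T)
substT-ds⊇ x t w ts T {_ , _} lv∈ with ∈-++⁻ (atoms w (VTs (fsub-ts x t ts))) lv∈
... | inj₂ inT = ∈-substT⁺ x t (atoms w (VTs ts) ++ T) (SubstVar-map (∈-++⁺ʳ (atoms w (VTs ts))) (∈-substT⁻ x t T inT))
... | inj₁ inM with ∈-map⁻ (λ y → w , y) inM
...   | _ , v∈ , refl =
  ∈-substT⁺ x t (atoms w (VTs ts) ++ T) (SubstVar-map (∈-++⁺ˡ ∘ ∈-map⁺ (λ y → w , y)) (∈-VTs-fsub⁻ x t ts v∈))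

Proof-resp-T : ∀ {C R T T′ Γ Δ} → T ⊆ T′ → T′ ⊆ T → (π : Proof C (seq R T Γ Δ)) →
               Σ (Proof C (seq R T′ Γ Δ)) λ π′ → height π′ ≤ height π
Proof-resp-T T⊆ T⊇ (ax Γ∋ Δ∋ w↠u) = ax Γ∋ Δ∋ w↠u , z≤n
Proof-resp-T T⊆ T⊇ (botL Γ∋) = botL Γ∋ , z≤n
Proof-resp-T T⊆ T⊇ (topR Δ∋) = topR Δ∋ , z≤n
Proof-resp-T T⊆ T⊇ (andL e p) =
  let p′ , hp = Proof-resp-T T⊆ T⊇ p in andL e p′ , s≤s hp
Proof-resp-T T⊆ T⊇ (andR e p q) =
  let p′ , hp = Proof-resp-T T⊆ T⊇ p ; q′ , hq = Proof-resp-T T⊆ T⊇ q in andR e p′ q′ , s≤s (⊔-mono-≤ hp hq)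
Proof-resp-T T⊆ T⊇ (orL e p q) =
  let p′ , hp = Proof-resp-T T⊆ T⊇ p ; q′ , hq = Proof-resp-T T⊆ T⊇ q in orL e p′ q′ , s≤s (⊔-mono-≤ hp hq)
Proof-resp-T T⊆ T⊇ (orR e p) =
  let p′ , hp = Proof-resp-T T⊆ T⊇ p in orR e p′ , s≤s hp
Proof-resp-T T⊆ T⊇ (impL Γ∋ w↠u p q) =
  let p′ , hp = Proof-resp-T T⊆ T⊇ p ; q′ , hq = Proof-resp-T T⊆ T⊇ q in impL Γ∋ w↠u p′ q′ , s≤s (⊔-mono-≤ hp hq)
Proof-resp-T {R = R} {Γ = Γ} {Δ = Δ} T⊆ T⊇ (impR e u-fresh p) =
  let p′ , hp = Proof-resp-T T⊆ T⊇ p in impR e (FreshL-T R Γ Δ T⊇ u-fresh) p′ , s≤s hp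
Proof-resp-T {R = R} {Γ = Γ} {Δ = Δ} T⊆ T⊇ (excL e u-fresh p) =
  let p′ , hp = Proof-resp-T T⊆ T⊇ p in excL e (FreshL-T R Γ Δ T⊇ u-fresh) p′ , s≤s hp
Proof-resp-T T⊆ T⊇ (excR Δ∋ w↠u p q) =
  let p′ , hp = Proof-resp-T T⊆ T⊇ p ; q′ , hq = Proof-resp-T T⊆ T⊇ q in excR Δ∋ w↠u p′ q′ , s≤s (⊔-mono-≤ hp hq)
Proof-resp-T {R = R} {Γ = Γ} {Δ = Δ} T⊆ T⊇ (exL {w = w} {y = y} e y-fresh p) =
  let p′ , hp = Proof-resp-T (∷⁺ʳ (w , y) T⊆) (∷⁺ʳ (w , y) T⊇) p in exL e (FreshV-T R Γ Δ T⊇ y-fresh) p′ , s≤s hp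
Proof-resp-T T⊆ T⊇ (exR Δ∋ t-avail p) =
  let p′ , hp = Proof-resp-T T⊆ T⊇ p in exR Δ∋ (Avail-⊆ T⊆ t-avail) p′ , s≤s hp
Proof-resp-T T⊆ T⊇ (allL Γ∋ w↠u t-avail p) =
  let p′ , hp = Proof-resp-T T⊆ T⊇ p in allL Γ∋ w↠u (Avail-⊆ T⊆ t-avail) p′ , s≤s hp
Proof-resp-T {R = R} {Γ = Γ} {Δ = Δ} T⊆ T⊇ (allR {u = u} {y = y} e u-fresh y-fresh p) =
  let p′ , hp = Proof-resp-T (∷⁺ʳ (u , y) T⊆) (∷⁺ʳ (u , y) T⊇) p
  in allR e (FreshL-T R Γ Δ T⊇ u-fresh) (FreshV-T R Γ Δ T⊇ y-fresh) p′ , s≤s hp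
Proof-resp-T T⊆ T⊇ (ds {w = w} {ts = ts} C≡ID Γ∋ p) =
  let p′ , hp = Proof-resp-T (++⁺ʳ (atoms w (VTs ts)) T⊆) (++⁺ʳ (atoms w (VTs ts)) T⊇) p
  in ds C≡ID Γ∋ p′ , s≤s hp

SubstAdmissibleUpTo : Calc → ℕ → Set
SubstAdmissibleUpTo C n = ∀ {S} (π : Proof C S) → height π ≤ n → ∀ x t →
                          Σ (Proof C (S [ t / x ]ˢ)) λ π′ → height π′ ≤ height π

substitute-renamed-premise : ∀ {C n R T Γ Δ Γ′ Δ′ l x y z} {t : Term 0} → SubstAdmissibleUpTo C n →
  (p : Proof C (seq R ((l , y) ∷ T) Γ Δ)) → height p ≤ n → y ∉ map proj₂ T → x ≢ z →
  substL x t (substL y (fv z) Γ) ≡ Γ′ → substL x t (substL y (fv z) Δ) ≡ Δ′ →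
  Σ (Proof C (seq R ((l , z) ∷ substT x t T) Γ′ Δ′)) λ p′ → height p′ ≤ height p
substitute-renamed-premise {T = T} {l = l} {x} {y} {z} {t} IH p h y∉T x≢z refl refl =
  let p₁ , h₁ = IH p h y (fv z)
      p₂ , h₂ = IH p₁ (≤-trans h₁ h) x t
      p₃ , h₃ = Proof-resp-T (substT-rename⊆ x t y z l T y∉T x≢z) (substT-rename⊇ x t y z l T y∉T x≢z) p₂
  in p₃ , ≤-trans h₃ (≤-trans h₂ h₁)

exL-substitution : ∀ {C n R T Γ Γ′ Δ w y φ} → SubstAdmissibleUpTo C n →
  Γ ↭ (w , ∃ᶠ φ) ∷ Γ′ → FreshV y (seq R T Γ Δ) →
  (p : Proof C (seq R ((w , y) ∷ T) ((w , φ ⟨ fv y ⟩) ∷ Γ′) Δ)) → height p ≤ n → ∀ x t →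
  Σ (Proof C (seq R T Γ Δ [ t / x ]ˢ)) λ π′ → height π′ ≤ suc (height p)
exL-substitution {R = R} {T} {Γ} {Γ′} {Δ} {w} {y} {φ} IH e y-fresh p h x t =
  let z , z-fresh , x≢z = freshVar x (vars (seq R T Γ Δ [ t / x ]ˢ))
      y∉T , y∉Γ , y∉Δ = FreshV-split (seq R T Γ Δ) y-fresh
      y∉φ∷Γ′ = All-resp-↭ e y∉Γ
      p′ , h′ = substitute-renamed-premise IH p h y∉T x≢z
                  (substL-rename-⟨⟩ x t y z w φ (All.head y∉φ∷Γ′) (All.tail y∉φ∷Γ′) x≢z)
                  (cong (substL x t) (substL-fresh (fv z) y∉Δ))
  in exL (↭-map⁺ (substLF x t) e) z-fresh p′ , s≤s h′

allR-substitution : ∀ {C n R T Γ Δ Δ′ w u y φ} → SubstAdmissibleUpTo C n →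
  Δ ↭ (w , ∀ᶠ φ) ∷ Δ′ → FreshL u (seq R T Γ Δ) → FreshV y (seq R T Γ Δ) →
  (p : Proof C (seq ((w , u) ∷ R) ((u , y) ∷ T) Γ ((u , φ ⟨ fv y ⟩) ∷ Δ′))) → height p ≤ n → ∀ x t →
  Σ (Proof C (seq R T Γ Δ [ t / x ]ˢ)) λ π′ → height π′ ≤ suc (height p)
allR-substitution {R = R} {T} {Γ} {Δ} {Δ′} {w} {u} {y} {φ} IH e u-fresh y-fresh p h x t =
  let z , z-fresh , x≢z = freshVar x (vars (seq R T Γ Δ [ t / x ]ˢ))
      y∉T , y∉Γ , y∉Δ = FreshV-split (seq R T Γ Δ) y-fresh
      y∉φ∷Δ′ = All-resp-↭ e y∉Δ
      p′ , h′ = substitute-renamed-premise IH p h y∉T x≢z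
                  (cong (substL x t) (substL-fresh (fv z) y∉Γ))
                  (substL-rename-⟨⟩ x t y z u φ (All.head y∉φ∷Δ′) (All.tail y∉φ∷Δ′) x≢z)
  in allR (↭-map⁺ (substLF x t) e) (FreshL-substT (seq R T Γ Δ) x t u-fresh) z-fresh p′ , s≤s h′

Proof-cast : ∀ {C S S′} → S ≡ S′ → (π : Proof C S) → Σ (Proof C S′) λ π′ → height π′ ≤ height π
Proof-cast refl π = π , ≤-refl

⊔-bound : ∀ {a b n} → suc (a ⊔ b) ≤ suc n → a ≤ n × b ≤ n
⊔-bound {a} {b} (s≤s h) = m⊔n≤o⇒m≤o a b h , m⊔n≤o⇒n≤o a b h

substitution : ∀ {C} n → SubstAdmissibleUpTo C n
substitution n (ax Γ∋ Δ∋ w↠u) _ x t = ax (∈-map⁺ (substLF x t) Γ∋) (∈-map⁺ (substLF x t) Δ∋) w↠u , z≤n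
substitution n (botL Γ∋) _ x t = botL (∈-map⁺ (substLF x t) Γ∋) , z≤n
substitution n (topR Δ∋) _ x t = topR (∈-map⁺ (substLF x t) Δ∋) , z≤n
substitution (suc n) (andL e p) (s≤s h) x t =
  let p′ , hp = substitution n p h x t in andL (↭-map⁺ (substLF x t) e) p′ , s≤s hp
substitution (suc n) (andR e p q) h x t =
  let hp , hq = ⊔-bound h ; p′ , hp′ = substitution n p hp x t ; q′ , hq′ = substitution n q hq x t
  in andR (↭-map⁺ (substLF x t) e) p′ q′ , s≤s (⊔-mono-≤ hp′ hq′)
substitution (suc n) (orL e p q) h x t =
  let hp , hq = ⊔-bound h ; p′ , hp′ = substitution n p hp x t ; q′ , hq′ = substitution n q hq x t
  in orL (↭-map⁺ (substLF x t) e) p′ q′ , s≤s (⊔-mono-≤ hp′ hq′)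
substitution (suc n) (orR e p) (s≤s h) x t =
  let p′ , hp = substitution n p h x t in orR (↭-map⁺ (substLF x t) e) p′ , s≤s hp
substitution (suc n) (impL Γ∋ w↠u p q) h x t =
  let hp , hq = ⊔-bound h ; p′ , hp′ = substitution n p hp x t ; q′ , hq′ = substitution n q hq x t
  in impL (∈-map⁺ (substLF x t) Γ∋) w↠u p′ q′ , s≤s (⊔-mono-≤ hp′ hq′)
substitution (suc n) (impR {R} {T} {Γ} {Δ} e u-fresh p) (s≤s h) x t =
  let p′ , hp = substitution n p h x t
  in impR (↭-map⁺ (substLF x t) e) (FreshL-substT (seq R T Γ Δ) x t u-fresh) p′ , s≤s hp
substitution (suc n) (excL {R} {T} {Γ} {Γ′} {Δ} e u-fresh p) (s≤s h) x t =
  let p′ , hp = substitution n p h x t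
  in excL (↭-map⁺ (substLF x t) e) (FreshL-substT (seq R T Γ Δ) x t u-fresh) p′ , s≤s hp
substitution (suc n) (excR Δ∋ w↠u p q) h x t =
  let hp , hq = ⊔-bound h ; p′ , hp′ = substitution n p hp x t ; q′ , hq′ = substitution n q hq x t
  in excR (∈-map⁺ (substLF x t) Δ∋) w↠u p′ q′ , s≤s (⊔-mono-≤ hp′ hq′)
substitution (suc n) (exL e y-fresh p) (s≤s h) x t = exL-substitution (substitution n) e y-fresh p h x t
substitution (suc n) (exR {R} {T} {Γ} {Δ} {w} {φ} {s} Δ∋ s-avail p) (s≤s h) x t =
  let p′ , hp = substitution n p h x t
      p″ , hp″ = Proof-cast (cong (λ ψ → seq R (substT x t T) (substL x t Γ) ((w , ψ) ∷ substL x t Δ))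
                                  (fsubF-⟨⟩ x t φ s)) p′
  in exR (∈-map⁺ (substLF x t) Δ∋) (Avail-substT x t s s-avail) p″ , s≤s (≤-trans hp″ hp)
substitution (suc n) (allL {R} {T} {Γ} {Δ} {u = u} {φ = φ} {t = s} Γ∋ w↠u s-avail p) (s≤s h) x t =
  let p′ , hp = substitution n p h x t
      p″ , hp″ = Proof-cast (cong (λ ψ → seq R (substT x t T) ((u , ψ) ∷ substL x t Γ) (substL x t Δ))
                                  (fsubF-⟨⟩ x t φ s)) p′
  in allL (∈-map⁺ (substLF x t) Γ∋) w↠u (Avail-substT x t s s-avail) p″ , s≤s (≤-trans hp″ hp)
substitution (suc n) (allR e u-fresh y-fresh p) (s≤s h) x t = allR-substitution (substitution n) e u-fresh y-fresh p h x t
substitution (suc n) (ds {T = T} {w = w} {ts = ts} C≡ID Γ∋ p) (s≤s h) x t =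
  let p′ , hp = substitution n p h x t
      p″ , hp″ = Proof-resp-T (substT-ds⊆ x t w ts T) (substT-ds⊇ x t w ts T) p′
  in ds C≡ID (∈-map⁺ (substLF x t) Γ∋) p″ , s≤s (≤-trans hp″ hp)

lemma33 : (C : Calc) (S : Sequent) (x : Var) (t : Term 0) (n : ℕ) →
          IsSequent S → (π : Proof C S) → height π ≡ n →
          Σ (Proof C (S [ t / x ]ˢ)) (λ π′ → height π′ ≤ n)
lemma33 C S x t n _ π refl = substitution n π ≤-refl x t
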